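{- $\liminf_{n\to\infty} a(n)/n=\frac{\varphi+2}{5}$ and $\limsup_{n\to\infty} a(n)/n=\varphi$.
   Context: $\varphi=(1+\sqrt5)/2$. Fibonacci numbers: $F_0=0$, $F_1=1$, $F_n=F_{n-1}+F_{n-2}$. The sequence $(a(n))_{n\geq 0}$ (OEIS A105774) is defined by $a(n)=n$ for $n\le 1$, and $a(n)=F_{j+1}-a(n-F_j)$ if $F_j<n\le F_{j+1}$ with $j\ge 2$. -}

module Defs where

open import Data.Nat as ℕ using (ℕ; zero; suc; _∸_)
open import Data.Integer as ℤ using (ℤ; +_)
open import Data.Rational as ℚ using (ℚ; _/_; 1ℚ; _+_; _*_; _-_; _<_)
open import Data.Product using (_×_; ∃; ∃-syntax)
open import Data.Sum using (_⊎_)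
open import Relation.Binary.PropositionalEquality using (_≡_)

fib : ℕ → ℕ
fib zero = zero
fib (suc zero) = suc zero
fib (suc (suc n)) = fib (suc n) ℕ.+ fib n

-- a : ℕ → ℤ satisfies the defining recursion of OEIS A105774:
-- a(n) = n for n ≤ 1, and a(n) = F_{j+1} - a(n - F_j) if F_j < n ≤ F_{j+1}, j ≥ 2.
-- (These equations determine a uniquely.)
IsA105774 : (ℕ → ℤ) → Set
IsA105774 a =
  (a 0 ≡ + 0) × (a 1 ≡ + 1) ×
  (∀ (j n : ℕ) → 2 ℕ.≤ j → fib j ℕ.< n → n ℕ.≤ fib (suc j) →
     a n ≡ + fib (suc j) ℤ.- a (n ∸ fib j))

-- Exact comparisons of a rational r with φ = (1+√5)/2 (the positive root of x² = x + 1).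
-- r < φ
BelowPhi : ℚ → Set
BelowPhi r = (r < 1ℚ) ⊎ (r * r < r + 1ℚ)

AbovePhi : ℚ → Set
AbovePhi r = (1ℚ < r) × (r + 1ℚ < r * r)

five two : ℚ
five = + 5 / 1
two = + 2 / 1

-- r < (φ+2)/5  ⇔  5r - 2 < φ
BelowL : ℚ → Set
BelowL r = BelowPhi (five * r - two)

-- (φ+2)/5 < r  ⇔  φ < 5r - 2
AboveL : ℚ → Set
AboveL r = AbovePhi (five * r - two)

-- A real number L is represented by its strict lower cut (below r ⇔ r < L) and
-- strict upper cut (above r ⇔ L < r), both sets of rationals.
-- liminf x = L :
LimInfIs : (ℕ → ℚ) → (ℚ → Set) → (ℚ → Set) → Set
LimInfIs x below above =
  (∀ r → below r → ∃[ N ] (∀ n → N ℕ.≤ n → r < x n)) ×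
  (∀ r → above r → ∀ N → ∃[ n ] (N ℕ.≤ n × x n < r))

LimSupIs : (ℕ → ℚ) → (ℚ → Set) → (ℚ → Set) → Set
LimSupIs x below above =
  (∀ r → above r → ∃[ N ] (∀ n → N ℕ.≤ n → x n < r)) ×
  (∀ r → below r → ∀ N → ∃[ n ] (N ℕ.≤ n × r < x n))

-- the sequence a(n)/n for n ≥ 1 (indexed by k = n - 1)
ratio : (ℕ → ℤ) → ℕ → ℚ
ratio a k = a (suc k) / suc k

-- Split n ≥ 2 into the blocks F_{j+2} < n ≤ F_{j+3}, on which a(n) = F_{j+3} - a(n - F_{j+2}).
-- Then F_{j+2} ≤ a(n) ≤ F_{j+3}, so a(n)/n < F_{j+3}/F_{j+2} → φ, and a(F_{j+2} + 1) = F_{j+3} - 1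
-- shows that φ is approached. Unfolding the recursion once more splits a block at F_{j+2} + F_j:
-- below that point a(n) ≥ F_{j+3} - F_j keeps a(n)/n ≥ 6/7, and above it
-- a(F_{j+2} + F_j + m) = F_{j+2} + a(m). For N/D < (φ+2)/5 = lim F_{j+2}/(F_{j+2} + F_j) the
-- excess δ(n) = a(n) D - N n therefore satisfies
--   δ(F_{j+2} + F_j + m) = (D - N) F_{j+1} - (2N - D) F_j + δ(m),
-- where the Fibonacci-linear increment tends to +∞; by strong induction δ is bounded below,
-- hence eventually positive, and m = 1 shows that (φ+2)/5 is approached.
-- Each comparison with φ comes down to α F_{k+1} - γ F_k → ∞ when γ/α < φ, which holds because
-- Cassini's identity F_{k+1}² - F_{k+1} F_k - F_k² = ±1 makes F_{k+1}/F_k approximate φ to within 1/F_k².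

module Submission where

open import Defs
open import Data.Nat using (ℕ)
open import Data.Integer using (ℤ)
open import Data.Rational using (ℚ; 1ℚ)
open import Data.Product using (_×_)

open import Data.Nat as ℕ using (zero; suc; z≤n; s≤s)
open import Data.Nat.Induction using (<-rec)
import Data.Nat.Properties as ℕ
open import Data.Integer as ℤ using (+_; -[1+_]; 0ℤ; 1ℤ; _+_; _-_; _*_; -_; _≤_; _<_; +≤+; +<+; -≤+)
import Data.Integer.Properties as ℤ
open import Data.Integer.Tactic.RingSolver using (solve; solve-∀)
open import Data.List using (_∷_; [])
open import Data.Product using (_,_; proj₁; proj₂; map₁; map₂; ∃; ∃-syntax)
open import Data.Sum using (_⊎_; inj₁; inj₂; [_,_]′)
open import Data.Empty using (⊥; ⊥-elim)
import Data.Rational as ℚ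
import Data.Rational.Properties as ℚ
import Data.Rational.Unnormalised as ℚᵘ
import Data.Rational.Unnormalised.Properties as ℚᵘ
open import Function using (_∘_; case_of_)
open import Relation.Nullary using (yes; no; contradiction)
open import Relation.Binary.PropositionalEquality

Eventually : (ℕ → Set) → Set
Eventually P = ∃[ K ] (∀ k → K ℕ.≤ k → P k)

Frequently : (ℕ → Set) → Set
Frequently P = ∀ K → ∃[ k ] (K ℕ.≤ k × P k)

eventually-mono : ∀ {P Q : ℕ → Set} → (∀ {k} → P k → Q k) → Eventually P → Eventually Q
eventually-mono P⇒Q (K , ev) = K , λ k K≤k → P⇒Q (ev k K≤k)

eventually-+ : ∀ {P : ℕ → Set} c → Eventually P → Eventually (λ k → P (c ℕ.+ k))
eventually-+ c (K , ev) = K , λ k K≤k → ev (c ℕ.+ k) (ℕ.≤-trans K≤k (ℕ.m≤n+m k c))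

frequently-mono : ∀ {P Q : ℕ → Set} → (∀ {k} → P k → Q k) → Frequently P → Frequently Q
frequently-mono P⇒Q fr K with fr K
... | k , K≤k , Pk = k , K≤k , P⇒Q Pk

frequently-along : ∀ {P : ℕ → Set} (w : ℕ → ℕ) → (∀ i → i ℕ.≤ w i) →
                   Eventually (P ∘ w) → Frequently P
frequently-along w i≤w (I , ev) K =
  w (I ℕ.+ K) , ℕ.≤-trans (ℕ.m≤n+m K I) (i≤w (I ℕ.+ K)) , ev (I ℕ.+ K) (ℕ.m≤m+n I K)

-- Integer positivity certificates

0≤+ : ∀ {i j} → 0ℤ ≤ i → 0ℤ ≤ j → 0ℤ ≤ i + j
0≤+ = ℤ.+-mono-≤

0<+ : ∀ {i j} → 0ℤ < i → 0ℤ ≤ j → 0ℤ < i + j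
0<+ = ℤ.+-mono-<-≤

0≤* : ∀ {i j} → 0ℤ ≤ i → 0ℤ ≤ j → 0ℤ ≤ i * j
0≤* {+ m} {+ n} _ _ = subst (0ℤ ≤_) (ℤ.pos-* m n) (+≤+ z≤n)
0≤* { -[1+ _ ]} ()
0≤* {+ _} { -[1+ _ ]} _ ()

0<* : ∀ {i j} → 0ℤ < i → 0ℤ < j → 0ℤ < i * j
0<* {+ suc m} {+ suc n} _ _ = subst (0ℤ <_) (ℤ.pos-* (suc m) (suc n)) (+<+ (s≤s z≤n))
0<* {+ zero} (+<+ ())
0<* { -[1+ _ ]} ()
0<* {+ suc _} {+ zero} _ (+<+ ())
0<* {+ suc _} { -[1+ _ ]} _ ()

0≤- : ∀ {i j} → i ≤ j → 0ℤ ≤ j - i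
0≤- = ℤ.i≤j⇒0≤j-i

0<- : ∀ {i j} → i < j → 0ℤ < j - i
0<- {i} {j} i<j = subst₂ _<_ (ℤ.+-inverseʳ i) refl (ℤ.+-monoˡ-< (- i) i<j)

0≤-1 : ∀ {i} → 0ℤ < i → 0ℤ ≤ i - 1ℤ
0≤-1 0<i = 0≤- (ℤ.i<j⇒suc[i]≤j 0<i)

0≤<+ : ∀ {i j} → 0ℤ ≤ i → 0ℤ < j → 0ℤ < i + j
0≤<+ = ℤ.+-mono-≤-<

0<-by-identity : ∀ {i j} → 0ℤ < i → i ≡ j → 0ℤ < j
0<-by-identity 0<i refl = 0<i

0≤-by-identity : ∀ {i j} → 0ℤ ≤ i → i ≡ j → 0ℤ ≤ j
0≤-by-identity 0≤i refl = 0≤i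

0≤-absurd : ∀ {i} → 0ℤ ≤ i → i + 1ℤ ≡ 0ℤ → ⊥
0≤-absurd {i} 0≤i i+1≡0 = case subst (1ℤ ≤_) i+1≡0 (ℤ.+-monoˡ-≤ 1ℤ 0≤i) of λ { (+≤+ ()) }

≤-by-difference : ∀ {i j e} → 0ℤ ≤ e → j - i ≡ e → i ≤ j
≤-by-difference 0≤e eq = ℤ.0≤i-j⇒j≤i (subst (0ℤ ≤_) (sym eq) 0≤e)

<-by-difference : ∀ {i j e} → 0ℤ < e → j - i ≡ e → i < j
<-by-difference {i} {j} 0<e eq =
  subst₂ _<_ (ℤ.+-identityˡ i) j-i+i≡j (ℤ.+-monoˡ-< i (subst (0ℤ <_) (sym eq) 0<e))
  where
  j-i+i≡j : j - i + i ≡ j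
  j-i+i≡j = solve (i ∷ j ∷ [])

0<*⇒0< : ∀ {i j} → 0ℤ < j → 0ℤ < i * j → 0ℤ < i
0<*⇒0< {+ suc _} _ _ = +<+ (s≤s z≤n)
0<*⇒0< {+ zero} _ (+<+ ())
0<*⇒0< { -[1+ _ ]} {+ suc _} _ ()
0<*⇒0< { -[1+ _ ]} {+ zero} (+<+ ()) _
0<*⇒0< { -[1+ _ ]} { -[1+ _ ]} () _

0≤+n : ∀ n → 0ℤ ≤ + n
0≤+n n = +≤+ z≤n

0<+suc : ∀ n → 0ℤ < + suc n
0<+suc n = +<+ (s≤s z≤n)

-- Fibonacci numbers and their blocks

interval-offset : ∀ {x y m} → x ℕ.< m → m ℕ.≤ x ℕ.+ y → ∃[ m′ ] (0 ℕ.< m′ × m′ ℕ.≤ y × m ≡ x ℕ.+ m′)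
interval-offset {x} {y} {m} x<m m≤x+y =
  m ℕ.∸ x , ℕ.m<n⇒0<n∸m x<m , ℕ.m≤n+o⇒m∸n≤o m x m≤x+y , sym (ℕ.m+[n∸m]≡n (ℕ.<⇒≤ x<m))

fib-≤-suc : ∀ k → fib k ℕ.≤ fib (suc k)
fib-≤-suc zero = z≤n
fib-≤-suc (suc zero) = ℕ.≤-refl
fib-≤-suc (suc (suc k)) = ℕ.m≤m+n _ _

fib-mono : ∀ {i k} → i ℕ.≤ k → fib i ℕ.≤ fib k
fib-mono {k = zero} z≤n = ℕ.≤-refl
fib-mono {k = suc k} i≤1+k with ℕ.m≤n⇒m<n∨m≡n i≤1+k
... | inj₁ i<1+k = ℕ.≤-trans (fib-mono (ℕ.≤-pred i<1+k)) (fib-≤-suc k)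
... | inj₂ refl = ℕ.≤-refl

fib-cancel-< : ∀ {i k} → fib i ℕ.< fib k → i ℕ.< k
fib-cancel-< {i} {k} fi<fk with k ℕ.≤? i
... | yes k≤i = contradiction (fib-mono {k} {i} k≤i) (ℕ.<⇒≱ fi<fk)
... | no k≰i = ℕ.≰⇒> k≰i

fib-suc-pos : ∀ k → 0 ℕ.< fib (suc k)
fib-suc-pos k = fib-mono {1} {suc k} (s≤s z≤n)

k≤fib[1+k] : ∀ k → k ℕ.≤ fib (suc k)
k≤fib[1+k] zero = z≤n
k≤fib[1+k] (suc zero) = ℕ.≤-refl
k≤fib[1+k] (suc (suc k)) =
  subst (ℕ._≤ fib (3 ℕ.+ k)) (ℕ.+-comm (suc k) 1) (ℕ.+-mono-≤ (k≤fib[1+k] (suc k)) (fib-suc-pos k))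

fib-block : ∀ n → 2 ℕ.≤ n →
            ∃[ j ] ∃[ m ] (0 ℕ.< m × m ℕ.≤ fib (suc j) × n ≡ fib (2 ℕ.+ j) ℕ.+ m)
fib-block (suc zero) (s≤s ())
fib-block (suc (suc zero)) _ = 0 , 1 , s≤s z≤n , s≤s z≤n , refl
fib-block (suc (suc (suc n))) _ with fib-block (suc (suc n)) (s≤s (s≤s z≤n))
... | j , m , 0<m , m≤ , eq with ℕ.m≤n⇒m<n∨m≡n m≤
...   | inj₁ m<F = j , suc m , s≤s z≤n , m<F , trans (cong suc eq) (sym (ℕ.+-suc (fib (2 ℕ.+ j)) m))
...   | inj₂ refl = suc j , 1 , s≤s z≤n , fib-suc-pos (suc j) , trans (cong suc eq) (ℕ.+-comm 1 (fib (3 ℕ.+ j)))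

block-index-≥ : ∀ {J j m} → fib (2 ℕ.+ J) ℕ.< fib (2 ℕ.+ j) ℕ.+ m → m ℕ.≤ fib (suc j) → J ℕ.≤ j
block-index-≥ {j = j} lt m≤ =
  ℕ.≤-pred (ℕ.≤-pred (ℕ.≤-pred (fib-cancel-< (ℕ.<-≤-trans lt (ℕ.+-monoʳ-≤ (fib (2 ℕ.+ j)) m≤)))))

late-block : ∀ J n → fib (2 ℕ.+ J) ℕ.< n →
  ∃[ j ] ∃[ m ] (J ℕ.≤ j × 0 ℕ.< m × m ℕ.≤ fib (suc j) × n ≡ fib (2 ℕ.+ j) ℕ.+ m)
late-block J n F<n with fib-block n (ℕ.≤-trans (s≤s (fib-suc-pos (suc J))) F<n)
... | j , m , 0<m , m≤ , n≡ = j , m , block-index-≥ (subst (fib (2 ℕ.+ J) ℕ.<_) n≡ F<n) m≤ , 0<m , m≤ , n≡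

eventually-from-blocks : ∀ {P : ℕ → Set} J →
  (∀ j m → J ℕ.≤ j → 0 ℕ.< m → m ℕ.≤ fib (suc j) → P (fib (2 ℕ.+ j) ℕ.+ m)) →
  Eventually (λ k → P (suc k))
eventually-from-blocks {P} J onBlocks = fib (2 ℕ.+ J) , λ k F≤k →
  let j , m , J≤j , 0<m , m≤ , 1+k≡ = late-block J (suc k) (s≤s F≤k)
  in subst P (sym 1+k≡) (onBlocks j m J≤j 0<m m≤)

F : ℕ → ℤ
F k = + fib k

cassini : ∀ k → ℤ.∣ F (suc k) * F (suc k) - F (suc k) * F k - F k * F k ∣ ≡ 1
cassini zero = refl
cassini (suc k) = trans (cong ℤ.∣_∣ (step x y)) (trans (ℤ.∣-i∣≡∣i∣ (x * x - x * y - y * y)) (cassini k))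
  where
  x = F (suc k)
  y = F k
  step : ∀ u v → (u + v) * (u + v) - (u + v) * u - u * u ≡ - (u * u - u * v - v * v)
  step = solve-∀

∣i∣≡1⇒-1≤i : ∀ {i} → ℤ.∣ i ∣ ≡ 1 → - 1ℤ ≤ i
∣i∣≡1⇒-1≤i {+ _} _ = -≤+
∣i∣≡1⇒-1≤i { -[1+ 0 ]} _ = ℤ.≤-refl
∣i∣≡1⇒-1≤i { -[1+ suc _ ]} ()

-- Comparisons with φ over ℤ

-- γ / α < φ, for α > 0
BelowPhiℤ : ℤ → ℤ → Set
BelowPhiℤ γ α = γ < α ⊎ γ * γ < γ * α + α * α

-- N / D > φ, for D > 0
AbovePhiℤ : ℤ → ℤ → Set
AbovePhiℤ N D = D < N × N * D + D * D < N * N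

-- A fraction x / y whose Cassini norm is at least -1 and whose denominator exceeds α
-- is too close to φ to lie below γ / α.
BelowPhiℤ⇒below-approximant : ∀ {α γ x y} → 0ℤ ≤ α → α < y → y ≤ x →
                   - 1ℤ ≤ x * x - x * y - y * y → BelowPhiℤ γ α → 0ℤ < α * x - γ * y
BelowPhiℤ⇒below-approximant {α} {γ} {x} {y} 0≤α α<y y≤x _ (inj₁ γ<α) =
  0<-by-identity (0≤<+ (0≤* 0≤α (0≤- y≤x)) (0<* (0<- γ<α) (ℤ.≤-<-trans 0≤α α<y)))
                 (solve (α ∷ γ ∷ x ∷ y ∷ []))
BelowPhiℤ⇒below-approximant {α} {γ} {x} {y} 0≤α α<y y≤x -1≤Q (inj₂ γ²<γα+α²) with 0ℤ ℤ.<? α * x - γ * y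
... | yes 0<G = 0<G
... | no 0≮G = ⊥-elim (0≤-absurd certificate (solve (α ∷ γ ∷ x ∷ y ∷ [])))
  where
  0≤y = ℤ.<⇒≤ (ℤ.≤-<-trans 0≤α α<y)
  0≤x = ℤ.≤-trans 0≤y y≤x
  0≤-G = 0≤- (ℤ.≮⇒≥ 0≮G)
  0≤y-α-1 = 0≤-1 (0<- α<y)
  certificate : 0ℤ ≤ (0ℤ - (α * x - γ * y)) * ((0ℤ - (α * x - γ * y)) + α * ((x - y) + x))
                     + (α * α) * ((x * x - x * y - y * y) - - 1ℤ)
                     + (y * y) * (((γ * α + α * α) - γ * γ) - 1ℤ)
                     + ((y - α) - 1ℤ) * (y + α)
                     + ((((y - α) - 1ℤ) + α) + α)
  certificate =
    0≤+ (0≤+ (0≤+ (0≤+ (0≤* 0≤-G (0≤+ 0≤-G (0≤* 0≤α (0≤+ (0≤- y≤x) 0≤x))))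
                        (0≤* (0≤* 0≤α 0≤α) (0≤- -1≤Q)))
                   (0≤* (0≤* 0≤y 0≤y) (0≤-1 (0<- γ²<γα+α²))))
              (0≤* 0≤y-α-1 (0≤+ 0≤y 0≤α)))
        (0≤+ (0≤+ 0≤y-α-1 0≤α) 0≤α)

AbovePhiℤ⇒D/[N-D]<φ : ∀ {N D} → AbovePhiℤ N D → 0ℤ < N - D × BelowPhiℤ D (N - D)
AbovePhiℤ⇒D/[N-D]<φ {N} {D} (D<N , ND+D²<N²) =
  0<- D<N , inj₂ (<-by-difference (0<- ND+D²<N²) (solve (N ∷ D ∷ [])))

AbovePhiℤ⇒4D<3N : ∀ {N D} → 0ℤ < D → AbovePhiℤ N D → + 4 * D < + 3 * N
AbovePhiℤ⇒4D<3N {N} {D} 0<D (D<N , ND+D²<N²) =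
  <-by-difference (0<*⇒0< {+ 3 * N - + 4 * D} 3N+4D>0 [3N-4D][3N+4D]>0) refl
  where
  0≤D = ℤ.<⇒≤ 0<D
  3N+4D>0 : 0ℤ < + 3 * N + + 4 * D
  3N+4D>0 = 0<+ (0<* (0<+suc 2) (ℤ.<-trans 0<D D<N)) (0≤* (0≤+n 4) 0≤D)
  [3N-4D][3N+4D]>0 : 0ℤ < (+ 3 * N - + 4 * D) * (+ 3 * N + + 4 * D)
  [3N-4D][3N+4D]>0 =
    0<-by-identity (0<+ (0<* (0<+suc 8) (0<- ND+D²<N²))
                        (0≤+ (0≤* (0≤* (0≤+n 9) 0≤D) (0≤- (ℤ.<⇒≤ D<N))) (0≤* (0≤+n 2) (0≤* 0≤D 0≤D))))
                   (solve (N ∷ D ∷ []))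

BelowPhiℤ⇒N<2D : ∀ {N D} → 0ℤ < D → BelowPhiℤ N D → N < + 2 * D
BelowPhiℤ⇒N<2D {N} {D} 0<D (inj₁ N<D) = ℤ.<-≤-trans N<D (≤-by-difference (ℤ.<⇒≤ 0<D) (solve (D ∷ [])))
BelowPhiℤ⇒N<2D {N} {D} 0<D (inj₂ N²<ND+D²) with N ℤ.<? + 2 * D
... | yes N<2D = N<2D
... | no N≮2D = ⊥-elim (0≤-absurd certificate (solve (N ∷ D ∷ [])))
  where
  0≤D = ℤ.<⇒≤ 0<D
  0≤N-2D = 0≤- (ℤ.≮⇒≥ N≮2D)
  certificate : 0ℤ ≤ (N - + 2 * D) * ((N - + 2 * D) + D) + (+ 2 * D) * (N - + 2 * D) + D * D
                     + ((N * D + D * D) - N * N - 1ℤ)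
  certificate = 0≤+ (0≤+ (0≤+ (0≤* 0≤N-2D (0≤+ 0≤N-2D 0≤D)) (0≤* (0≤* (0≤+n 2) 0≤D) 0≤N-2D))
                          (0≤* 0≤D 0≤D))
                    (0≤-1 (0<- N²<ND+D²))

AbovePhiℤ[5N-2D]⇒[D-N]/[3N-2D]<φ : ∀ {N D} → 0ℤ < D → AbovePhiℤ (+ 5 * N - + 2 * D) D →
                                    0ℤ < + 3 * N - + 2 * D × BelowPhiℤ (D - N) (+ 3 * N - + 2 * D)
AbovePhiℤ[5N-2D]⇒[D-N]/[3N-2D]<φ {N} {D} 0<D T>φD@(_ , TD+D²<T²) =
  0<*⇒0< (0<+suc 4) 5[3N-2D]>0 , inj₂ (<-by-difference (0<*⇒0< (0<+suc 4) 5·gap>0) refl)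
  where
  5[3N-2D]>0 : 0ℤ < (+ 3 * N - + 2 * D) * + 5
  5[3N-2D]>0 = 0<-by-identity (0<- (AbovePhiℤ⇒4D<3N 0<D T>φD)) (solve (N ∷ D ∷ []))
  5·gap>0 : 0ℤ < ((D - N) * (+ 3 * N - + 2 * D) + (+ 3 * N - + 2 * D) * (+ 3 * N - + 2 * D) - (D - N) * (D - N)) * + 5
  5·gap>0 = 0<-by-identity (0<- TD+D²<T²) (solve (N ∷ D ∷ []))

BelowPhiℤ[5N-2D]⇒[2N-D]/[D-N]<φ : ∀ {N D} → 0ℤ ≤ N → 0ℤ < D → BelowPhiℤ (+ 5 * N - + 2 * D) D →
                                    0ℤ < + 6 * D - + 7 * N × BelowPhiℤ (+ 2 * N - D) (D - N)
BelowPhiℤ[5N-2D]⇒[2N-D]/[D-N]<φ {N} {D} 0≤N 0<D T<φD =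
  0<*⇒0< (0<+suc 4) 5[6D-7N]>0 , gap T<φD
  where
  5[6D-7N]>0 : 0ℤ < (+ 6 * D - + 7 * N) * + 5
  5[6D-7N]>0 = 0<-by-identity (0<+ (0<* (0<+suc 6) (0<- (BelowPhiℤ⇒N<2D 0<D T<φD))) (0≤* (0≤+n 2) (ℤ.<⇒≤ 0<D)))
                              (solve (N ∷ D ∷ []))
  gap : BelowPhiℤ (+ 5 * N - + 2 * D) D → BelowPhiℤ (+ 2 * N - D) (D - N)
  gap (inj₁ T<D) = inj₁ (<-by-difference (0<*⇒0< (0<+suc 2) 3·gap>0) refl)
    where
    3·gap>0 : 0ℤ < ((D - N) - (+ 2 * N - D)) * + 3
    3·gap>0 = 0<-by-identity (0<+ (0<* (0<+suc 1) (0<- T<D)) 0≤N) (solve (N ∷ D ∷ []))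
  gap (inj₂ T²<TD+D²) = inj₂ (<-by-difference (0<*⇒0< (0<+suc 4) 5·gap>0) refl)
    where
    5·gap>0 : 0ℤ < ((+ 2 * N - D) * (D - N) + (D - N) * (D - N) - (+ 2 * N - D) * (+ 2 * N - D)) * + 5
    5·gap>0 = 0<-by-identity (0<- T²<TD+D²) (solve (N ∷ D ∷ []))

-- Linear forms in consecutive Fibonacci numbers

fibForm : ℤ → ℤ → ℕ → ℤ
fibForm α γ k = α * F (suc k) - γ * F k

fibForm-rec : ∀ α γ k → fibForm α γ (2 ℕ.+ k) ≡ fibForm α γ (suc k) + fibForm α γ k
fibForm-rec α γ k = rec α γ (F (suc k)) (F k)
  where
  rec : ∀ α γ x y → α * ((x + y) + x) - γ * (x + y) ≡ (α * (x + y) - γ * x) + (α * x - γ * y)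
  rec = solve-∀

fibForm-eventually-pos : ∀ {α γ} → 0ℤ < α → BelowPhiℤ γ α → Eventually (λ k → 0ℤ < fibForm α γ k)
fibForm-eventually-pos {+ a} 0<α γ<φα = 2 ℕ.+ a , λ k 2+a≤k →
  BelowPhiℤ⇒below-approximant (ℤ.<⇒≤ 0<α) (+<+ (ℕ.<-≤-trans (k≤fib[1+k] (suc a)) (fib-mono 2+a≤k)))
                   (+≤+ (fib-≤-suc k)) (∣i∣≡1⇒-1≤i (cassini k)) γ<φα

i≤+∣i∣ : ∀ i → i ≤ + ℤ.∣ i ∣
i≤+∣i∣ (+ _) = ℤ.≤-refl
i≤+∣i∣ -[1+ _ ] = -≤+

recurrent-unbounded : (g : ℕ → ℤ) → (∀ k → g (2 ℕ.+ k) ≡ g (suc k) + g k) →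
                      Eventually (λ k → 0ℤ < g k) → ∀ M → Eventually (λ k → M ≤ g k)
recurrent-unbounded g rec (K , pos) M = ℤ.∣ M ∣ ℕ.+ K , λ k ∣M∣+K≤k →
  subst (λ n → M ≤ g n) (ℕ.m∸n+n≡m (ℕ.≤-trans (ℕ.m≤n+m K ℤ.∣ M ∣) ∣M∣+K≤k))
        (ℤ.≤-trans (i≤+∣i∣ M) (ℤ.≤-trans (+≤+ (ℕ.m+n≤o⇒m≤o∸n ℤ.∣ M ∣ ∣M∣+K≤k)) (linear (k ℕ.∸ K))))
  where
  linear : ∀ t → + t ≤ g (t ℕ.+ K)
  linear zero = ℤ.<⇒≤ (pos K ℕ.≤-refl)
  linear (suc zero) = ℤ.i<j⇒suc[i]≤j (pos (suc K) (ℕ.n≤1+n K))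
  linear (suc (suc t)) =
    subst (+ suc (suc t) ≤_) (trans (ℤ.+-comm (g (t ℕ.+ K)) _) (sym (rec (t ℕ.+ K))))
          (ℤ.+-mono-≤ (ℤ.i<j⇒suc[i]≤j (pos (t ℕ.+ K) (ℕ.m≤n+m K t))) (linear (suc t)))

fibForm-unbounded : ∀ {α γ} → 0ℤ < α → BelowPhiℤ γ α → ∀ M → Eventually (λ k → M ≤ fibForm α γ k)
fibForm-unbounded {α} {γ} 0<α γ<φα =
  recurrent-unbounded (fibForm α γ) (fibForm-rec α γ) (fibForm-eventually-pos 0<α γ<φα)

-- Rationals as integer fractions

-- x equals A / (1 + b), compared in ℚᵘ where numerators and denominators are not normalised
Represents : ℚ → ℤ → ℕ → Set
Represents x A b = ℚ.toℚᵘ x ℚᵘ.≃ ℚᵘ.mkℚᵘ A b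

represents-self : ∀ r → Represents r (ℚ.↥ r) (ℚ.ℚ.denominator-1 r)
represents-self (ℚ.mkℚ _ _ _) = ℚᵘ.≃-refl

represents-/ : ∀ A b → Represents (A ℚ./ suc b) A b
represents-/ A b = ℚ.toℚᵘ-fromℚᵘ (ℚᵘ.mkℚᵘ A b)

represents-* : ∀ {x y A B a b} → Represents x A a → Represents y B b →
               Represents (x ℚ.* y) (A * B) (b ℕ.+ a ℕ.* suc b)
represents-* {x} {y} x≃A y≃B = ℚᵘ.≃-trans (ℚ.toℚᵘ-homo-* x y) (ℚᵘ.*-cong x≃A y≃B)

represents-+ : ∀ {x y A B a b} → Represents x A a → Represents y B b →
               Represents (x ℚ.+ y) (A * + suc b + B * + suc a) (b ℕ.+ a ℕ.* suc b)
represents-+ {x} {y} x≃A y≃B = ℚᵘ.≃-trans (ℚ.toℚᵘ-homo-+ x y) (ℚᵘ.+-cong x≃A y≃B)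

represents-neg : ∀ {x A a} → Represents x A a → Represents (ℚ.- x) (- A) a
represents-neg {x} x≃A = ℚᵘ.≃-trans (ℚ.toℚᵘ-homo‿- x) (ℚᵘ.-‿cong x≃A)

represents-cong : ∀ {x A B a b} → Represents x A a → A ≡ B → a ≡ b → Represents x B b
represents-cong x≃A refl refl = x≃A

<⇒cross-< : ∀ {x y A B a b} → Represents x A a → Represents y B b →
            x ℚ.< y → A * + suc b < B * + suc a
<⇒cross-< x≃A y≃B x<y with ℚᵘ.<-respʳ-≃ y≃B (ℚᵘ.<-respˡ-≃ x≃A (ℚ.toℚᵘ-mono-< x<y))
... | ℚᵘ.*<* A<B = A<B

cross-<⇒< : ∀ {x y A B a b} → Represents x A a → Represents y B b →
            A * + suc b < B * + suc a → x ℚ.< y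
cross-<⇒< x≃A y≃B A<B =
  ℚ.toℚᵘ-cancel-< (ℚᵘ.<-respʳ-≃ (ℚᵘ.≃-sym y≃B) (ℚᵘ.<-respˡ-≃ (ℚᵘ.≃-sym x≃A) (ℚᵘ.*<* A<B)))

<-ratio : ∀ r A k → ℚ.↥ r * + suc k < A * ℚ.↧ r → r ℚ.< A ℚ./ suc k
<-ratio r A k = cross-<⇒< (represents-self r) (represents-/ A k)

ratio-< : ∀ r A k → A * ℚ.↧ r < ℚ.↥ r * + suc k → A ℚ./ suc k ℚ.< r
ratio-< r A k = cross-<⇒< (represents-/ A k) (represents-self r)

represents-1 : Represents 1ℚ 1ℤ 0
represents-1 = represents-/ 1ℤ 0

-- the two sides of s * s < s + 1, cross-multiplied for s = T / (1 + e), up to the common factor 1 + e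
s²-cross : ∀ T e → (T * T) * + suc (0 ℕ.+ e ℕ.* 1) ≡ (T * T) * + suc e
s²-cross T e = cong (λ n → T * T * + suc n) (ℕ.*-identityʳ e)

[s+1]-cross : ∀ T e → (T * 1ℤ + 1ℤ * + suc e) * + suc (e ℕ.+ e ℕ.* suc e)
                      ≡ (T * + suc e + + suc e * + suc e) * + suc e
[s+1]-cross T e = distrib T (+ suc e)
  where
  distrib : ∀ T D → (T * 1ℤ + 1ℤ * D) * (D * D) ≡ (T * D + D * D) * D
  distrib = solve-∀

BelowPhi⇒BelowPhiℤ : ∀ {s T e} → Represents s T e → BelowPhi s → BelowPhiℤ T (+ suc e)
BelowPhi⇒BelowPhiℤ {T = T} s≃T (inj₁ s<1) =
  inj₁ (subst₂ _<_ (ℤ.*-identityʳ T) (ℤ.*-identityˡ _) (<⇒cross-< s≃T represents-1 s<1))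
BelowPhi⇒BelowPhiℤ {T = T} {e} s≃T (inj₂ s²<s+1) =
  inj₂ (ℤ.*-cancelʳ-<-nonNeg (+ suc e) (subst₂ _<_ (s²-cross T e) ([s+1]-cross T e)
         (<⇒cross-< (represents-* s≃T s≃T) (represents-+ s≃T represents-1) s²<s+1)))

AbovePhi⇒AbovePhiℤ : ∀ {s T e} → Represents s T e → AbovePhi s → AbovePhiℤ T (+ suc e)
AbovePhi⇒AbovePhiℤ {T = T} {e} s≃T (1<s , s+1<s²) =
  subst₂ _<_ (ℤ.*-identityˡ _) (ℤ.*-identityʳ T) (<⇒cross-< represents-1 s≃T 1<s) ,
  ℤ.*-cancelʳ-<-nonNeg (+ suc e) (subst₂ _<_ ([s+1]-cross T e) (s²-cross T e)
    (<⇒cross-< (represents-+ s≃T represents-1) (represents-* s≃T s≃T) s+1<s²))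

represents-5r-2 : ∀ r → Represents (five ℚ.* r ℚ.- two) (+ 5 * ℚ.↥ r - + 2 * ℚ.↧ r) (ℚ.ℚ.denominator-1 r)
represents-5r-2 r =
  represents-cong (represents-+ (represents-* (represents-/ (+ 5) 0) (represents-self r))
                                (represents-neg {two} (represents-/ (+ 2) 0)))
                  (numerator (ℚ.↥ r) (+ suc (d ℕ.+ 0)) (ℚ.↧ r) (cong (λ n → + suc n) (ℕ.+-identityʳ d)))
                  (trans (ℕ.*-identityʳ (d ℕ.+ 0)) (ℕ.+-identityʳ d))
  where
  d = ℚ.ℚ.denominator-1 r
  numerator : ∀ N D′ D → D′ ≡ D → + 5 * N * 1ℤ + - + 2 * D′ ≡ + 5 * N - + 2 * D
  numerator N D′ D refl = solve (N ∷ D′ ∷ [])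

BelowL⇒BelowPhiℤ : ∀ r → BelowL r → BelowPhiℤ (+ 5 * ℚ.↥ r - + 2 * ℚ.↧ r) (ℚ.↧ r)
BelowL⇒BelowPhiℤ r = BelowPhi⇒BelowPhiℤ (represents-5r-2 r)

AboveL⇒AbovePhiℤ : ∀ r → AboveL r → AbovePhiℤ (+ 5 * ℚ.↥ r - + 2 * ℚ.↧ r) (ℚ.↧ r)
AboveL⇒AbovePhiℤ r = AbovePhi⇒AbovePhiℤ (represents-5r-2 r)

-- The sequence a

module _ {a : ℕ → ℤ} (isA : IsA105774 a) where

  a-step : ∀ j m → 0 ℕ.< m → m ℕ.≤ fib (suc j) → a (fib (2 ℕ.+ j) ℕ.+ m) ≡ F (3 ℕ.+ j) - a m
  a-step j m 0<m m≤ =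
    trans (proj₂ (proj₂ isA) (2 ℕ.+ j) _ (s≤s (s≤s z≤n)) (ℕ.m<m+n (fib (2 ℕ.+ j)) 0<m)
                             (ℕ.+-monoʳ-≤ (fib (2 ℕ.+ j)) m≤))
          (cong (λ n → F (3 ℕ.+ j) - a n) (ℕ.m+n∸m≡n (fib (2 ℕ.+ j)) m))

  a-step-bounds : ∀ j m → 0 ℕ.< m → m ℕ.≤ fib (suc j) → 0ℤ ≤ a m × a m ≤ F (suc j) →
                  F (2 ℕ.+ j) ≤ a (fib (2 ℕ.+ j) ℕ.+ m) × a (fib (2 ℕ.+ j) ℕ.+ m) ≤ F (3 ℕ.+ j)
  a-step-bounds j m 0<m m≤ (0≤am , am≤F) rewrite a-step j m 0<m m≤ =
    ≤-by-difference (0≤- am≤F) (shift (F (2 ℕ.+ j)) (F (suc j)) (a m)) ,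
    ≤-by-difference 0≤am (cancel (F (3 ℕ.+ j)) (a m))
    where
    shift : ∀ x y z → (x + y) - z - x ≡ y - z
    shift = solve-∀
    cancel : ∀ x z → x - (x - z) ≡ z
    cancel = solve-∀

  a-bounded : ∀ k m → m ℕ.≤ fib k → 0ℤ ≤ a m × a m ≤ F k
  a-bounded zero zero _ rewrite proj₁ isA = ℤ.≤-refl , ℤ.≤-refl
  a-bounded (suc zero) m m≤1 = a-≤1 m m≤1
    where
    a-≤1 : ∀ m → m ℕ.≤ 1 → 0ℤ ≤ a m × a m ≤ 1ℤ
    a-≤1 zero _ rewrite proj₁ isA = ℤ.≤-refl , 0≤+n 1
    a-≤1 (suc zero) _ rewrite proj₁ (proj₂ isA) = 0≤+n 1 , ℤ.≤-refl
    a-≤1 (suc (suc _)) (s≤s ())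
  a-bounded (suc (suc zero)) m m≤1 = a-bounded (suc zero) m m≤1
  a-bounded (suc (suc (suc k))) m m≤ =
    [ lower-block (a-bounded (suc (suc k)) m) , upper-block (a-bounded (suc k)) ]′
    (ℕ.≤-<-connex m (fib (2 ℕ.+ k)))
    where
    Bound : ℕ → Set
    Bound n = 0ℤ ≤ a n × a n ≤ F (3 ℕ.+ k)
    lower-block : (m ℕ.≤ fib (2 ℕ.+ k) → 0ℤ ≤ a m × a m ≤ F (2 ℕ.+ k)) → m ℕ.≤ fib (2 ℕ.+ k) → Bound m
    lower-block bounded m≤F = map₂ (λ a≤F → ℤ.≤-trans a≤F (+≤+ (fib-≤-suc (2 ℕ.+ k)))) (bounded m≤F)
    upper-block : (∀ m′ → m′ ℕ.≤ fib (suc k) → 0ℤ ≤ a m′ × a m′ ≤ F (suc k)) → fib (2 ℕ.+ k) ℕ.< m → Bound m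
    upper-block bounded F<m =
      let m′ , 0<m′ , m′≤ , m≡ = interval-offset F<m m≤
      in subst Bound (sym m≡) (map₁ (ℤ.≤-trans (0≤+n _)) (a-step-bounds k m′ 0<m′ m′≤ (bounded m′ m′≤)))

  a-block-bounds : ∀ j m → 0 ℕ.< m → m ℕ.≤ fib (suc j) →
                   F (2 ℕ.+ j) ≤ a (fib (2 ℕ.+ j) ℕ.+ m) × a (fib (2 ℕ.+ j) ℕ.+ m) ≤ F (3 ℕ.+ j)
  a-block-bounds j m 0<m m≤ = a-step-bounds j m 0<m m≤ (a-bounded (suc j) m m≤)

  a-fib+1 : ∀ j → a (suc (fib (2 ℕ.+ j))) ≡ F (3 ℕ.+ j) - 1ℤ
  a-fib+1 j = subst (λ n → a n ≡ F (3 ℕ.+ j) - 1ℤ) (ℕ.+-comm (fib (2 ℕ.+ j)) 1)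
                    (trans (a-step j 1 (s≤s z≤n) (fib-suc-pos j)) (cong (λ z → F (3 ℕ.+ j) - z) (proj₁ (proj₂ isA))))

  a-lower-half : ∀ i m → 0 ℕ.< m → m ℕ.≤ fib (2 ℕ.+ i) → F (5 ℕ.+ i) - F (2 ℕ.+ i) ≤ a (fib (4 ℕ.+ i) ℕ.+ m)
  a-lower-half i m 0<m m≤ =
    subst (F (5 ℕ.+ i) - F (2 ℕ.+ i) ≤_) (sym (a-step (2 ℕ.+ i) m 0<m (ℕ.≤-trans m≤ (fib-≤-suc (2 ℕ.+ i)))))
          (ℤ.+-monoʳ-≤ (F (5 ℕ.+ i)) (ℤ.neg-mono-≤ (proj₂ (a-bounded (2 ℕ.+ i) m m≤))))

  a-upper-half : ∀ i m → 0 ℕ.< m → m ℕ.≤ fib (suc i) →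
                 a (fib (4 ℕ.+ i) ℕ.+ (fib (2 ℕ.+ i) ℕ.+ m)) ≡ F (5 ℕ.+ i) - (F (3 ℕ.+ i) - a m)
  a-upper-half i m 0<m m≤ =
    trans (a-step (2 ℕ.+ i) (fib (2 ℕ.+ i) ℕ.+ m) (ℕ.<-≤-trans 0<m (ℕ.m≤n+m m _)) (ℕ.+-monoʳ-≤ (fib (2 ℕ.+ i)) m≤))
          (cong (λ z → F (5 ℕ.+ i) - z) (a-step i m 0<m m≤))

  a-eventually-below-φ : ∀ {N D} → 0ℤ < D → AbovePhiℤ N D → Eventually (λ k → a (suc k) * D < N * + suc k)
  a-eventually-below-φ {N} {D} 0<D N>φD@(D<N , _) =
    let 0<N-D , D<φ[N-D] = AbovePhiℤ⇒D/[N-D]<φ {N} {D} N>φD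
        J , form≥0 = fibForm-unbounded 0<N-D D<φ[N-D] 0ℤ
    in eventually-from-blocks {λ n → a n * D < N * + n} J λ j m J≤j 0<m m≤ →
         below-in-block (F (2 ℕ.+ j)) (F (suc j)) (proj₂ (a-block-bounds j m 0<m m≤))
                  (form≥0 (suc j) (ℕ.m≤n⇒m≤1+n J≤j)) (+<+ 0<m)
    where
    below-in-block : ∀ x y {A m} → A ≤ x + y → 0ℤ ≤ (N - D) * x - D * y → 0ℤ < m → A * D < N * (x + m)
    below-in-block x y {A} {m} A≤x+y form≥0 0<m =
      <-by-difference (0≤<+ (0≤+ form≥0 (0≤* (ℤ.<⇒≤ 0<D) (0≤- A≤x+y))) (0<* (ℤ.<-trans 0<D D<N) 0<m))
                      (solve (N ∷ D ∷ x ∷ y ∷ A ∷ m ∷ []))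

  a-frequently-above-φ : ∀ {N D} → 0ℤ < D → BelowPhiℤ N D → Frequently (λ k → N * + suc k < a (suc k) * D)
  a-frequently-above-φ {N} {D} 0<D N<φD =
    frequently-along (λ j → fib (2 ℕ.+ j)) (λ j → ℕ.≤-trans (ℕ.n≤1+n j) (k≤fib[1+k] (suc j)))
      (eventually-mono (λ {j} → after-fib j) (eventually-+ 2 (fibForm-unbounded 0<D N<φD (N + D + 1ℤ))))
    where
    after-fib : ∀ j → N + D + 1ℤ ≤ fibForm D N (2 ℕ.+ j) → N * + suc (fib (2 ℕ.+ j)) < a (suc (fib (2 ℕ.+ j))) * D
    after-fib j form≥ rewrite a-fib+1 j = at-witness (F (2 ℕ.+ j)) (F (suc j)) form≥
      where
      at-witness : ∀ x y → N + D + 1ℤ ≤ D * (x + y) - N * x → N * (1ℤ + x) < ((x + y) - 1ℤ) * D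
      at-witness x y form≥ = <-by-difference (0≤<+ (0≤- form≥) (0<+suc 0)) (solve (N ∷ D ∷ x ∷ y ∷ []))

  a-frequently-below-L : ∀ {N D} → 0ℤ < D → AbovePhiℤ (+ 5 * N - + 2 * D) D →
                         Frequently (λ k → a (suc k) * D < N * + suc k)
  a-frequently-below-L {N} {D} 0<D T>φD =
    let 0<α , γ<φα = AbovePhiℤ[5N-2D]⇒[D-N]/[3N-2D]<φ {N} 0<D T>φD
    in frequently-along witness witness-≥
         (eventually-mono (λ {j} → at-witness j) (eventually-+ 1 (fibForm-unbounded 0<α γ<φα (D - N + 1ℤ))))
    where
    witness : ℕ → ℕ
    witness j = fib (4 ℕ.+ j) ℕ.+ fib (2 ℕ.+ j)
    witness-≥ : ∀ j → j ℕ.≤ witness j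
    witness-≥ j = ℕ.≤-trans (ℕ.m≤n+m j 3) (ℕ.≤-trans (k≤fib[1+k] (3 ℕ.+ j)) (ℕ.m≤m+n _ _))
    1+witness : ∀ j → suc (witness j) ≡ fib (4 ℕ.+ j) ℕ.+ (fib (2 ℕ.+ j) ℕ.+ 1)
    1+witness j = trans (sym (ℕ.+-suc _ _)) (cong (fib (4 ℕ.+ j) ℕ.+_) (ℕ.+-comm 1 (fib (2 ℕ.+ j))))
    at-witness : ∀ j → D - N + 1ℤ ≤ fibForm (+ 3 * N - + 2 * D) (D - N) (1 ℕ.+ j) →
                 a (suc (witness j)) * D < N * + suc (witness j)
    at-witness j form≥ rewrite 1+witness j | a-upper-half j 1 (s≤s z≤n) (fib-suc-pos j) | proj₁ (proj₂ isA) =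
      inequality (F (2 ℕ.+ j)) (F (suc j)) form≥
      where
      inequality : ∀ u w → D - N + 1ℤ ≤ (+ 3 * N - + 2 * D) * u - (D - N) * w →
                   (((u + w) + u) + (u + w) - ((u + w) - 1ℤ)) * D < N * (((u + w) + u) + (u + 1ℤ))
      inequality u w form≥ = <-by-difference (0≤<+ (0≤- form≥) (0<+suc 0)) (solve (N ∷ D ∷ u ∷ w ∷ []))

  module LiminfLower {N D : ℤ} (0≤N : 0ℤ ≤ N) (6D-7N>0 : 0ℤ < + 6 * D - + 7 * N)
                     (γ<φα : BelowPhiℤ (+ 2 * N - D) (D - N)) where

    0<D-N : 0ℤ < D - N
    0<D-N = 0<*⇒0< (0<+suc 5) (0<-by-identity (0<+ 6D-7N>0 0≤N) (solve (N ∷ D ∷ [])))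

    0≤2D-N : 0ℤ ≤ + 2 * D - N
    0≤2D-N = ℤ.<⇒≤ (0<*⇒0< (0<+suc 2) (0<-by-identity (0<+ 6D-7N>0 (0≤* (0≤+n 4) 0≤N)) (solve (N ∷ D ∷ []))))

    0≤D : 0ℤ ≤ D
    0≤D = 0≤-by-identity (0≤+ (ℤ.<⇒≤ 0<D-N) 0≤N) (solve (N ∷ D ∷ []))

    defect : ℕ → ℤ
    defect n = a n * D - N * + n

    form : ℕ → ℤ
    form = fibForm (D - N) (+ 2 * N - D)

    defect-lower-half : ∀ i m → 0 ℕ.< m → m ℕ.≤ fib (2 ℕ.+ i) → 0ℤ < defect (fib (4 ℕ.+ i) ℕ.+ m)
    defect-lower-half i m 0<m m≤ =
      inequality (F (2 ℕ.+ i)) (F (suc i)) (+<+ (fib-suc-pos (suc i)))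
                 (+≤+ (ℕ.+-monoʳ-≤ (fib (suc i)) (fib-≤-suc i))) (+≤+ m≤) (a-lower-half i m 0<m m≤)
      where
      inequality : ∀ u w {m A} → 0ℤ < u → u ≤ w + w → m ≤ u → ((u + w) + u) + (u + w) - u ≤ A →
                   0ℤ < A * D - N * (((u + w) + u) + m)
      inequality u w {m} {A} 0<u u≤2w m≤u A≥ = 0<*⇒0< (0<+suc 1) doubled
        where
        doubled : 0ℤ < (A * D - N * (((u + w) + u) + m)) * + 2
        doubled = 0<-by-identity (0≤<+ (0≤+ (0≤+ (0≤* (0≤* (0≤+n 2) 0≤D) (0≤- A≥)) (0≤* (0≤* (0≤+n 2) 0≤N) (0≤- m≤u)))
                                             (0≤* 0≤2D-N (0≤- u≤2w)))
                                        (0<* 6D-7N>0 0<u))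
                                 (solve (N ∷ D ∷ u ∷ w ∷ m ∷ A ∷ []))

    defect-upper-half : ∀ i m → 0 ℕ.< m → m ℕ.≤ fib (suc i) →
                        defect (fib (4 ℕ.+ i) ℕ.+ (fib (2 ℕ.+ i) ℕ.+ m)) ≡ form (2 ℕ.+ i) + defect m
    defect-upper-half i m 0<m m≤ rewrite a-upper-half i m 0<m m≤ = identity (F (2 ℕ.+ i)) (F (suc i)) (a m) (+ m)
      where
      identity : ∀ u w A m → (((u + w) + u) + (u + w) - ((u + w) - A)) * D - N * (((u + w) + u) + (u + m))
                             ≡ ((D - N) * (u + w) - (+ 2 * N - D) * u) + (A * D - N * m)
      identity u w A m = solve (N ∷ D ∷ u ∷ w ∷ A ∷ m ∷ [])

    BlockOutcome : ℕ → ℕ → Set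
    BlockOutcome j n = 0ℤ < defect n ⊎ ∃[ m′ ] (m′ ℕ.< n × defect n ≡ form j + defect m′)

    defect-in-block : ∀ j m → 2 ℕ.≤ j → 0 ℕ.< m → m ℕ.≤ fib (suc j) → BlockOutcome j (fib (2 ℕ.+ j) ℕ.+ m)
    defect-in-block (suc zero) _ (s≤s ())
    defect-in-block (suc (suc i)) m _ 0<m m≤ =
      [ inj₁ ∘ defect-lower-half i m 0<m , inj₂ ∘ upper ]′ (ℕ.≤-<-connex m (fib (2 ℕ.+ i)))
      where
      upper : fib (2 ℕ.+ i) ℕ.< m →
              ∃[ m′ ] (m′ ℕ.< fib (4 ℕ.+ i) ℕ.+ m × defect (fib (4 ℕ.+ i) ℕ.+ m) ≡ form (2 ℕ.+ i) + defect m′)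
      upper F<m =
        let m′ , 0<m′ , m′≤ , m≡ = interval-offset F<m m≤
        in m′ , subst (λ m → m′ ℕ.< fib (4 ℕ.+ i) ℕ.+ m × defect (fib (4 ℕ.+ i) ℕ.+ m) ≡ form (2 ℕ.+ i) + defect m′)
                      (sym m≡)
                      ( ℕ.<-≤-trans (ℕ.m<n+m m′ (fib-suc-pos (3 ℕ.+ i))) (ℕ.+-monoʳ-≤ (fib (4 ℕ.+ i)) (ℕ.m≤n+m m′ _))
                      , defect-upper-half i m′ 0<m′ m′≤)

    defect-in-late-block : ∀ K n → fib (4 ℕ.+ K) ℕ.< n → ∃[ j ] (K ℕ.≤ j × BlockOutcome j n)
    defect-in-late-block K n F<n =
      let j , m , 2+K≤j , 0<m , m≤ , n≡ = late-block (2 ℕ.+ K) n F<n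
      in j , ℕ.≤-trans (ℕ.m≤n+m K 2) 2+K≤j ,
         subst (BlockOutcome j) (sym n≡) (defect-in-block j m (ℕ.≤-trans (ℕ.m≤m+n 2 K) 2+K≤j) 0<m m≤)

    module _ (K : ℕ) (form≥0 : ∀ k → K ℕ.≤ k → 0ℤ ≤ form k) where

      C : ℤ
      C = N * F (4 ℕ.+ K)

      defect-bounded : ∀ n → - C ≤ defect n
      defect-bounded = <-rec (λ n → - C ≤ defect n) λ n rec → [ early n , late n rec ]′ (ℕ.≤-<-connex n (fib (4 ℕ.+ K)))
        where
        early : ∀ n → n ℕ.≤ fib (4 ℕ.+ K) → - C ≤ defect n
        early n n≤ = inequality (proj₁ (a-bounded (4 ℕ.+ K) n n≤)) (+≤+ n≤)
          where
          inequality : ∀ {A n X} → 0ℤ ≤ A → n ≤ X → - (N * X) ≤ A * D - N * n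
          inequality {A} {n} {X} 0≤A n≤X =
            ≤-by-difference (0≤+ (0≤* 0≤A 0≤D) (0≤* 0≤N (0≤- n≤X))) (solve (N ∷ D ∷ A ∷ n ∷ X ∷ []))
        late : ∀ n → (∀ {m} → m ℕ.< n → - C ≤ defect m) → fib (4 ℕ.+ K) ℕ.< n → - C ≤ defect n
        late n rec F<n with defect-in-late-block K n F<n
        ... | _ , _ , inj₁ 0<δ = ℤ.≤-trans (ℤ.neg-mono-≤ (0≤* 0≤N (0≤+n _))) (ℤ.<⇒≤ 0<δ)
        ... | j , K≤j , inj₂ (m′ , m′<n , δ≡) = begin
          - C                 ≡⟨ ℤ.+-identityˡ (- C) ⟨
          0ℤ + - C            ≤⟨ ℤ.+-mono-≤ (form≥0 j K≤j) (rec m′<n) ⟩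
          form j + defect m′  ≡⟨ δ≡ ⟨
          defect n            ∎
          where open ℤ.≤-Reasoning

      defect-eventually-pos : ∀ K′ → (∀ k → K′ ℕ.≤ k → C + 1ℤ ≤ form k) → Eventually (λ k → 0ℤ < defect (suc k))
      defect-eventually-pos K′ form> = fib (4 ℕ.+ K′) , λ k F≤k → positive (defect-in-late-block K′ (suc k) (s≤s F≤k))
        where
        sum-pos : ∀ {x y} → C + 1ℤ ≤ x → - C ≤ y → 0ℤ < x + y
        sum-pos {x} {y} C+1≤x -C≤y = 0<-by-identity (0≤<+ (0≤+ (0≤- C+1≤x) (0≤- -C≤y)) (0<+suc 0)) (identity C x y)
          where
          identity : ∀ C x y → (x - (C + 1ℤ)) + (y - - C) + 1ℤ ≡ x + y
          identity = solve-∀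
        positive : ∀ {n} → ∃[ j ] (K′ ℕ.≤ j × BlockOutcome j n) → 0ℤ < defect n
        positive (_ , _ , inj₁ 0<δ) = 0<δ
        positive (j , K′≤j , inj₂ (m′ , _ , δ≡)) =
          subst (0ℤ <_) (sym δ≡) (sum-pos (form> j K′≤j) (defect-bounded m′))

  a-eventually-above-L : ∀ {N D} → 0ℤ < D → BelowPhiℤ (+ 5 * N - + 2 * D) D →
                         Eventually (λ k → N * + suc k < a (suc k) * D)
  a-eventually-above-L {N} {D} 0<D T<φD with N ℤ.≤? 0ℤ
  ... | yes N≤0 = eventually-from-blocks {λ n → N * + n < a n * D} 0 λ j m _ 0<m m≤ →
    nonpositive (ℤ.<-≤-trans (+<+ (fib-suc-pos (suc j))) (proj₁ (a-block-bounds j m 0<m m≤))) (0≤+n _)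
    where
    nonpositive : ∀ {A n} → 0ℤ < A → 0ℤ ≤ n → N * n < A * D
    nonpositive {A} {n} 0<A 0≤n = <-by-difference (0<+ (0<* 0<A 0<D) (0≤* (0≤- N≤0) 0≤n)) (solve (N ∷ D ∷ A ∷ n ∷ []))
  ... | no N≰0 =
    let 0≤N = ℤ.<⇒≤ (ℤ.≰⇒> N≰0)
        6D-7N>0 , γ<φα = BelowPhiℤ[5N-2D]⇒[2N-D]/[D-N]<φ {N} 0≤N 0<D T<φD
        open LiminfLower 0≤N 6D-7N>0 γ<φα
        K , form≥0 = fibForm-unbounded 0<D-N γ<φα 0ℤ
        K′ , form> = fibForm-unbounded 0<D-N γ<φα (C K form≥0 + 1ℤ)
    in eventually-mono (λ 0<δ → <-by-difference 0<δ refl) (defect-eventually-pos K form≥0 K′ form>)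

proposition7 : (a : ℕ → ℤ) → IsA105774 a →
    LimInfIs (ratio a) BelowL AboveL × LimSupIs (ratio a) BelowPhi AbovePhi
proposition7 a isA = (liminf-lower , liminf-upper) , (limsup-upper , limsup-lower)
  where
  liminf-lower : ∀ r → BelowL r → Eventually (λ k → r ℚ.< ratio a k)
  liminf-lower r r<L = eventually-mono (λ {k} → <-ratio r (a (suc k)) k)
    (a-eventually-above-L isA {ℚ.↥ r} (0<+suc _) (BelowL⇒BelowPhiℤ r r<L))

  liminf-upper : ∀ r → AboveL r → Frequently (λ k → ratio a k ℚ.< r)
  liminf-upper r L<r = frequently-mono (λ {k} → ratio-< r (a (suc k)) k)
    (a-frequently-below-L isA {ℚ.↥ r} (0<+suc _) (AboveL⇒AbovePhiℤ r L<r))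

  limsup-upper : ∀ r → AbovePhi r → Eventually (λ k → ratio a k ℚ.< r)
  limsup-upper r φ<r = eventually-mono (λ {k} → ratio-< r (a (suc k)) k)
    (a-eventually-below-φ isA (0<+suc _) (AbovePhi⇒AbovePhiℤ (represents-self r) φ<r))

  limsup-lower : ∀ r → BelowPhi r → Frequently (λ k → r ℚ.< ratio a k)
  limsup-lower r r<φ = frequently-mono (λ {k} → <-ratio r (a (suc k)) k)
    (a-frequently-above-φ isA (0<+suc _) (BelowPhi⇒BelowPhiℤ (represents-self r) r<φ))
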